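{- Let $n>2$. The lattice $(\mathfrak{C}(n)_\bot,\sqsubseteq)$ satisfies the Jordan–Dedekind chain condition (it is ranked), its height function is $h(S,\pi)=n-k+1$ when $\pi$ is a $k$-partition, and the height of the lattice is $n$.
   Context: Let $N=\{1,\dots,n\}$ and $\Pi(n)$ the lattice of partitions of $N$ ordered by refinement. An embedded subset is a pair $(S,\pi)$ with $S\subseteq N$ nonempty and $\pi\in\Pi(n)$ having $S$ as a block. $\mathfrak{C}(n)_\bot$ is the set of embedded subsets together with an added least element $\bot$, ordered by $(S,\pi)\sqsubseteq(S',\pi')$ iff $S\subseteq S'$ and $\pi$ refines $\pi'$. A $k$-partition is a partition with $k$ blocks. The height $h(x)$ is the length of any maximal chain from $\bot$ to $x$ (with $h(\bot)=0$). -}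

module Defs where

open import Data.Nat using (ℕ; zero; suc; _<ᵇ_)
open import Data.Bool using (Bool; true; false; T; not; _∧_)
open import Data.Fin using (Fin; toℕ)
open import Data.Fin.Subset using (Subset; _∈_; _⊆_; Nonempty)
open import Data.List using (List; []; _∷_; length; filterᵇ)
open import Data.Unit using (⊤)
open import Data.List using () renaming (allFin to allFinL)
open import Data.Product using (_×_; Σ; ∃)
open import Data.Empty using (⊥)
open import Relation.Nullary using (¬_)
open import Function.Bundles using (_⇔_)

-- A partition of N = Fin n, given as a (decidable) equivalence relation:
-- i and j are related iff they lie in the same block.
record Partition (n : ℕ) : Set where
  field
    rel     : Fin n → Fin n → Bool
    rel-refl  : ∀ i → T (rel i i)
    rel-sym   : ∀ i j → T (rel i j) → T (rel j i)
    rel-trans : ∀ i j k → T (rel i j) → T (rel j k) → T (rel i k)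
open Partition public

Refines : ∀ {n} → Partition n → Partition n → Set
Refines π π' = ∀ i j → T (rel π i j) → T (rel π' i j)

IsBlock : ∀ {n} → Subset n → Partition n → Set
IsBlock {n} S π = Nonempty S × (∀ (i j : Fin n) → i ∈ S → (j ∈ S ⇔ T (rel π i j)))

allL : ∀ {A : Set} → (A → Bool) → List A → Bool
allL p [] = true
allL p (x ∷ xs) = p x ∧ allL p xs

isLeader : ∀ {n} → Partition n → Fin n → Bool
isLeader {n} π i = allL (λ j → not ((toℕ j <ᵇ toℕ i) ∧ rel π j i)) (allFinL n)

-- number of blocks of π (one leader per block)
numBlocks : ∀ {n} → Partition n → ℕ
numBlocks {n} π = length (filterᵇ (isLeader π) (allFinL n))

data C (n : ℕ) : Set where
  bot : C n
  emb : (S : Subset n) (π : Partition n) → IsBlock S π → C n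

_⊑_ : ∀ {n} → C n → C n → Set
bot ⊑ _ = ⊤
emb _ _ _ ⊑ bot = ⊥
emb S π _ ⊑ emb S' π' _ = (S ⊆ S') × Refines π π'

_⊏_ : ∀ {n} → C n → C n → Set
x ⊏ y = (x ⊑ y) × ¬ (y ⊑ x)

_⋖_ : ∀ {n} → C n → C n → Set
_⋖_ {n} x y = (x ⊏ y) × (∀ (z : C n) → x ⊏ z → ¬ (z ⊏ y))

data Chain {n : ℕ} : C n → C n → ℕ → Set where
  [] : ∀ {x} → Chain x x 0
  _∷_ : ∀ {x y z m} → x ⊏ y → Chain y z m → Chain x z (suc m)

-- MaxChain x y m : a maximal chain from x to y of length m
-- (every step is a covering, so no element can be inserted)
data MaxChain {n : ℕ} : C n → C n → ℕ → Set where
  [] : ∀ {x} → MaxChain x x 0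
  _∷_ : ∀ {x y z m} → x ⋖ y → MaxChain y z m → MaxChain x z (suc m)

-- Rank C(n)⊥ by r(⊥) = 0 and r(S, π) = n − k + 1 for a k-partition π. Coarsening a partition
-- never increases its number of blocks, and strictly decreases it if some pair becomes related,
-- so r is strictly monotone. Conversely, between x ⊏ y there is always some z with x ⊏ z ⊑ y
-- and r z = r x + 1: merge two blocks of π that the partition of y joins and take the new block
-- containing S. Hence the covering steps are exactly the steps raising r by one, every maximal
-- chain from x to y has length r y − r x, and r is the height function.
--
-- Blocks are counted by their least elements ("leaders"); merging two blocks demotes exactly
-- one leader, namely the larger of the two.
module Submission where

open import Defs
open import Data.Nat using (ℕ; _<_; _≤_; _+_; _∸_)
open import Data.Product using (_×_; Σ; ∃)
open import Relation.Binary.PropositionalEquality using (_≡_)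

open import Data.Bool using (Bool; true; false; T; not; _∧_; _∨_)
open import Data.Bool.Properties using (T-∧; T-∨; T-≡)
open import Data.Empty using (⊥; ⊥-elim)
open import Data.Fin using (Fin; toℕ) renaming (zero to fzero; suc to fsuc; _<_ to _<ᶠ_)
open import Data.Fin.Induction using (<-wellFounded)
open import Data.Fin.Properties using (toℕ-injective; ¬∀⟶∃¬; all?; _≟_)
open import Data.Fin.Subset using (Subset; _∈_; _⊆_)
open import Data.List using (List; []; _∷_; length; filterᵇ; allFin; tabulate)
open import Data.List.Membership.Propositional using () renaming (_∈_ to _∈ₗ_)
open import Data.List.Membership.Propositional.Properties using (∈-allFin)
open import Data.List.Properties using (length-filter; length-tabulate; filter-all; filter-none)
open import Data.List.Relation.Unary.All as All using (All; []; _∷_)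
open import Data.List.Relation.Unary.All.Properties using (tabulate⁺)
open import Data.List.Relation.Unary.AllPairs using ([]; _∷_)
open import Data.List.Relation.Unary.Any using (here; there)
open import Data.List.Relation.Unary.Unique.Propositional using (Unique)
open import Data.List.Relation.Unary.Unique.Propositional.Properties using (allFin⁺)
open import Data.Nat using (zero; suc; z≤n; s≤s; _<ᵇ_; _≤?_)
open import Data.Nat.Properties
  using (≤-refl; ≤-reflexive; ≤-trans; ≤-antisym; <-irrefl; <-≤-trans; <⇒≤; <⇒≱; ≮⇒≥; ≰⇒>;
         <⇒<ᵇ; <ᵇ⇒<; m≤n⇒m≤1+n; m≤n+m; m≤m+n; +-comm; +-suc; +-identityʳ; +-cancelʳ-≡;
         +-monoˡ-≤; +-monoʳ-≤; +-monoˡ-<; ∸-monoʳ-≤; ∸-monoʳ-<; n∸n≡0; m∸n+n≡m; module ≤-Reasoning)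
open import Data.Product using (_,_; proj₁)
open import Data.Sum using (_⊎_; inj₁; inj₂)
open import Data.Unit using (tt)
import Data.Vec as Vec
open import Data.Vec.Properties using (lookup∘tabulate; []=⇒lookup; lookup⇒[]=)
open import Function using (_∘_; id)
open import Function.Bundles using (_⇔_; Equivalence; mk⇔)
open import Induction.WellFounded using (Acc; acc)
open import Relation.Binary.PropositionalEquality
  using (_≢_; refl; sym; trans; cong; subst; module ≡-Reasoning)
open import Relation.Nullary using (¬_; yes; no; contradiction)
open import Relation.Nullary.Decidable using (T?; _→-dec_; ⌊_⌋; toWitness; fromWitness)

module _ {A : Set} where

  count : (A → Bool) → List A → ℕ
  count p xs = length (filterᵇ p xs)

  count-mono : ∀ {p q xs} → All (λ x → T (p x) → T (q x)) xs → count p xs ≤ count q xs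
  count-mono {p} {q} {[]}     []               = z≤n
  count-mono {p} {q} {x ∷ xs} (px⇒qx ∷ p⇒q) with p x | q x
  ... | true  | true  = s≤s (count-mono p⇒q)
  ... | true  | false = ⊥-elim (px⇒qx tt)
  ... | false | true  = m≤n⇒m≤1+n (count-mono p⇒q)
  ... | false | false = count-mono p⇒q

  count-mono-< : ∀ {p q t xs} → All (λ x → T (p x) → T (q x)) xs →
                 t ∈ₗ xs → ¬ T (p t) → T (q t) → count p xs < count q xs
  count-mono-< {p} {q} {xs = x ∷ xs} (px⇒qx ∷ p⇒q) (here refl) ¬pt qt with p x | q x
  ... | true  | _     = ⊥-elim (¬pt tt)
  ... | false | true  = s≤s (count-mono p⇒q)
  count-mono-< {p} {q} {xs = x ∷ xs} (px⇒qx ∷ p⇒q) (there t∈) ¬pt qt with p x | q x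
  ... | true  | false = ⊥-elim (px⇒qx tt)
  ... | true  | true  = s≤s (count-mono-< p⇒q t∈ ¬pt qt)
  ... | false | true  = m≤n⇒m≤1+n (count-mono-< p⇒q t∈ ¬pt qt)
  ... | false | false = count-mono-< p⇒q t∈ ¬pt qt

  count-≤-suc : ∀ {p q} → (∀ x y → T (p x) → ¬ T (q x) → T (p y) → ¬ T (q y) → x ≡ y) →
                ∀ {xs} → Unique xs → count p xs ≤ suc (count q xs)
  count-≤-suc {p} {q} atMostOne {[]}     []           = z≤n
  count-≤-suc {p} {q} atMostOne {x ∷ xs} (x∉xs ∷ !xs) with p x in px | q x in qx
  ... | true  | true  = s≤s (count-≤-suc atMostOne !xs)
  ... | false | true  = m≤n⇒m≤1+n (count-≤-suc atMostOne !xs)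
  ... | false | false = count-≤-suc atMostOne !xs
  ... | true  | false = s≤s (count-mono (All.map p⇒q x∉xs))
    where
    p⇒q : ∀ {y} → x ≢ y → T (p y) → T (q y)
    p⇒q {y} x≢y py with q y in qy
    ... | true  = tt
    ... | false =
      contradiction (atMostOne x y (subst T (sym px) tt) (subst T qx) py (subst T qy)) x≢y

  T-allL : ∀ {p : A → Bool} {xs} → T (allL p xs) ⇔ All (λ x → T (p x)) xs
  T-allL {p} {[]}     = mk⇔ (λ _ → []) (λ _ → tt)
  T-allL {p} {x ∷ xs} = mk⇔
    (λ t → let px , rest = Equivalence.to (T-∧ {p x} {allL p xs}) t
           in px ∷ Equivalence.to T-allL rest)
    (λ { (px ∷ rest) →
           Equivalence.from (T-∧ {p x} {allL p xs}) (px , Equivalence.from T-allL rest) })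

T-not⇒¬T : ∀ {b} → T (not b) → ¬ T b
T-not⇒¬T {true} ()

¬T⇒T-not : ∀ {b} → ¬ T b → T (not b)
¬T⇒T-not {true}  ¬t = ¬t tt
¬T⇒T-not {false} _  = tt

rel-euclid : ∀ {n} (π : Partition n) {i a b} → T (rel π i a) → T (rel π i b) → T (rel π a b)
rel-euclid π {i} {a} {b} i~a i~b = rel-trans π a i b (rel-sym π i a i~a) i~b

module _ {n : ℕ} (π : Partition n) where

  isLeader-minimal : ∀ {a b} → T (isLeader π a) → T (rel π b a) → toℕ a ≤ toℕ b
  isLeader-minimal {a} {b} leader b~a = ≮⇒≥ λ b<a →
    T-not⇒¬T (All.lookup (Equivalence.to T-allL leader) (∈-allFin b))
             (Equivalence.from (T-∧ {toℕ b <ᵇ toℕ a} {rel π b a}) (<⇒<ᵇ b<a , b~a))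

  isLeader-intro : ∀ {a} → (∀ b → T (rel π b a) → toℕ a ≤ toℕ b) → T (isLeader π a)
  isLeader-intro {a} minimal =
    Equivalence.from (T-allL {xs = allFin n}) (All.tabulate λ {b} _ → ¬T⇒T-not λ t →
      let b<a , b~a = Equivalence.to (T-∧ {toℕ b <ᵇ toℕ a} {rel π b a}) t
      in <⇒≱ (<ᵇ⇒< (toℕ b) (toℕ a) b<a) (minimal b b~a))

  ¬isLeader⇒smaller : ∀ {a} → ¬ T (isLeader π a) → ∃ λ b → toℕ b < toℕ a × T (rel π b a)
  ¬isLeader⇒smaller {a} ¬leader
    with ¬∀⟶∃¬ n _ (λ b → T? (rel π b a) →-dec toℕ a ≤? toℕ b) (¬leader ∘ isLeader-intro)
  ... | b , ¬minimal with T? (rel π b a)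
  ...   | yes b~a = b , ≰⇒> (λ a≤b → ¬minimal λ _ → a≤b) , b~a
  ...   | no ¬b~a = ⊥-elim (¬minimal λ b~a → contradiction b~a ¬b~a)

  isLeader-unique : ∀ {a b} → T (isLeader π a) → T (isLeader π b) → T (rel π a b) → a ≡ b
  isLeader-unique {a} {b} la lb a~b =
    toℕ-injective (≤-antisym (isLeader-minimal la (rel-sym π a b a~b)) (isLeader-minimal lb a~b))

  isLeader-unique′ : ∀ {i a b} → T (isLeader π a) → T (isLeader π b) →
                     T (rel π i a) → T (rel π i b) → a ≡ b
  isLeader-unique′ la lb i~a i~b = isLeader-unique la lb (rel-euclid π i~a i~b)

  leaderOf : ∀ a → ∃ λ l → T (isLeader π l) × T (rel π l a)
  leaderOf a = go a (<-wellFounded a)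
    where
    go : ∀ a → Acc _<ᶠ_ a → ∃ λ l → T (isLeader π l) × T (rel π l a)
    go a (acc smaller) with T? (isLeader π a)
    ... | yes leader = a , leader , rel-refl π a
    ... | no ¬leader with ¬isLeader⇒smaller ¬leader
    ...   | b , b<a , b~a with go b (smaller b<a)
    ...     | l , leader , l~b = l , leader , rel-trans π l b a l~b b~a

module _ {n : ℕ} (π π′ : Partition n) (π≤π′ : Refines π π′) where

  isLeader-refines : ∀ {a} → T (isLeader π′ a) → T (isLeader π a)
  isLeader-refines leader = isLeader-intro π λ b b~a → isLeader-minimal π′ leader (π≤π′ b _ b~a)

  numBlocks-antitone : numBlocks π′ ≤ numBlocks π
  numBlocks-antitone = count-mono {xs = allFin n} (All.tabulate λ _ → isLeader-refines)

  numBlocks-< : ∀ {l} → T (isLeader π l) → ¬ T (isLeader π′ l) → numBlocks π′ < numBlocks π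
  numBlocks-< {l} leader ¬leader′ =
    count-mono-< {xs = allFin n} (All.tabulate λ _ → isLeader-refines) (∈-allFin l) ¬leader′ leader

  -- The π-leaders of i and j differ, and at most one of them leads their common π′-block.
  numBlocks-strict : ∀ {i j} → T (rel π′ i j) → ¬ T (rel π i j) → numBlocks π′ < numBlocks π
  numBlocks-strict {i} {j} i~′j ¬i~j
    with leaderOf π i | leaderOf π j
  ... | li , li-leader , li~i | lj , lj-leader , lj~j
    with T? (isLeader π′ li) | T? (isLeader π′ lj)
  ... | no ¬li-leader′ | _ = numBlocks-< li-leader ¬li-leader′
  ... | yes _ | no ¬lj-leader′ = numBlocks-< lj-leader ¬lj-leader′
  ... | yes li-leader′ | yes lj-leader′ = ⊥-elim (¬i~j i~j)
    where
    li~′lj : T (rel π′ li lj)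
    li~′lj = rel-trans π′ li i lj (π≤π′ li i li~i)
               (rel-trans π′ i j lj i~′j (rel-sym π′ lj j (π≤π′ lj j lj~j)))
    i~j : T (rel π i j)
    i~j = rel-euclid π li~i
            (subst (λ l → T (rel π l j)) (sym (isLeader-unique π′ li-leader′ lj-leader′ li~′lj)) lj~j)

¬Refines⇒separated : ∀ {n} (π π′ : Partition n) → ¬ Refines π π′ →
                     ∃ λ i → ∃ λ j → T (rel π i j) × ¬ T (rel π′ i j)
¬Refines⇒separated {n} π π′ ¬π≤π′
  with ¬∀⟶∃¬ n _ (λ i → all? λ j → T? (rel π i j) →-dec T? (rel π′ i j)) ¬π≤π′
... | i , ¬i-ok with ¬∀⟶∃¬ n _ (λ j → T? (rel π i j) →-dec T? (rel π′ i j)) ¬i-ok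
...   | j , ¬ij-ok with T? (rel π i j)
...     | yes i~j = i , j , i~j , λ i~′j → ¬ij-ok λ _ → i~′j
...     | no ¬i~j = ⊥-elim (¬ij-ok λ i~j → contradiction i~j ¬i~j)

module _ {n : ℕ} where

  numBlocks-≤ : (π : Partition n) → numBlocks π ≤ n
  numBlocks-≤ π =
    subst (numBlocks π ≤_) (length-tabulate id) (length-filter (T? ∘ isLeader π) (allFin n))

  discrete : Partition n
  discrete = record
    { rel       = λ a b → ⌊ a ≟ b ⌋
    ; rel-refl  = λ a → fromWitness refl
    ; rel-sym   = λ a b a≡b → fromWitness (sym (toWitness a≡b))
    ; rel-trans = λ a b c a≡b b≡c → fromWitness (trans (toWitness a≡b) (toWitness b≡c))
    }

  discrete-refines : (π : Partition n) → Refines discrete π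
  discrete-refines π a b a≡b = subst (T ∘ rel π a) (toWitness a≡b) (rel-refl π a)

  numBlocks-discrete : numBlocks discrete ≡ n
  numBlocks-discrete =
    trans (cong length (filter-all (T? ∘ isLeader discrete) everyLeader)) (length-tabulate id)
    where
    everyLeader : All (T ∘ isLeader discrete) (allFin n)
    everyLeader = All.tabulate λ _ → isLeader-intro discrete λ b b≡a →
      ≤-reflexive (cong toℕ (sym (toWitness b≡a)))

module _ {m : ℕ} where

  numBlocks-suc : (π : Partition (suc m)) → numBlocks π ≡ suc (count (isLeader π) (tabulate fsuc))
  numBlocks-suc π with isLeader π fzero | isLeader-intro π {fzero} (λ _ _ → z≤n)
  ... | true | _ = refl

  indiscrete : Partition (suc m)
  indiscrete = record
    { rel       = λ _ _ → true
    ; rel-refl  = λ _ → tt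
    ; rel-sym   = λ _ _ _ → tt
    ; rel-trans = λ _ _ _ _ _ → tt
    }

  numBlocks-indiscrete : numBlocks indiscrete ≡ 1
  numBlocks-indiscrete = trans (numBlocks-suc indiscrete)
    (cong (suc ∘ length) (filter-none (T? ∘ isLeader indiscrete) (tabulate⁺ λ i leader →
      contradiction (isLeader-minimal indiscrete {fsuc i} {fzero} leader tt) λ ())))

numBlocks-pos : ∀ {n} (π : Partition n) → Fin n → 0 < numBlocks π
numBlocks-pos {suc m} π _ = subst (0 <_) (sym (numBlocks-suc π)) (s≤s z≤n)

module _ {n : ℕ} where

  blockOf : Partition n → Fin n → Subset n
  blockOf π s = Vec.tabulate (rel π s)

  ∈-blockOf : ∀ π {s a} → a ∈ blockOf π s ⇔ T (rel π s a)
  ∈-blockOf π {s} {a} = mk⇔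
    (λ a∈ → Equivalence.from T-≡ (trans (sym (lookup∘tabulate (rel π s) a)) ([]=⇒lookup a∈)))
    (λ s~a → lookup⇒[]= a _ (trans (lookup∘tabulate (rel π s) a) (Equivalence.to T-≡ s~a)))

  blockOf-isBlock : (π : Partition n) (s : Fin n) → IsBlock (blockOf π s) π
  blockOf-isBlock π s = (s , Equivalence.from (∈-blockOf π) (rel-refl π s)) , λ a b a∈ →
    let s~a = Equivalence.to (∈-blockOf π) a∈ in mk⇔
    (λ b∈ → rel-euclid π s~a (Equivalence.to (∈-blockOf π) b∈))
    (λ a~b → Equivalence.from (∈-blockOf π) (rel-trans π s a b s~a a~b))

  block-⊆ : ∀ {S S′ : Subset n} {s} (π π′ : Partition n) → Refines π π′ →
            IsBlock S π → IsBlock S′ π′ → s ∈ S → s ∈ S′ → S ⊆ S′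
  block-⊆ {s = s} π π′ π≤π′ (_ , S-block) (_ , S′-block) s∈S s∈S′ {a} a∈S =
    Equivalence.from (S′-block s a s∈S′) (π≤π′ s a (Equivalence.to (S-block s a s∈S) a∈S))

module _ {n : ℕ} (π : Partition n) where

  LeadsAbove : Fin n → Fin n → Fin n → Set
  LeadsAbove i j x = T (rel π i x) × ∃ λ b → toℕ b < toℕ x × T (rel π j b)

  -- The leader x of i's block lies above some b ~ j, whose leader y lies above some c ~ i:
  -- then x ≤ c < y ≤ b < x.
  ¬leadsAbove-both : ∀ {i j x y} → T (isLeader π x) → T (isLeader π y) →
                     LeadsAbove i j x → LeadsAbove j i y → ⊥
  ¬leadsAbove-both {i} {j} {x} {y} x-leader y-leader (i~x , b , b<x , j~b) (j~y , c , c<y , i~c) =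
    <-irrefl refl (<-≤-trans b<x (≤-trans x≤c (≤-trans (<⇒≤ c<y) y≤b)))
    where
    x≤c : toℕ x ≤ toℕ c
    x≤c = isLeader-minimal π x-leader (rel-euclid π i~c i~x)
    y≤b : toℕ y ≤ toℕ b
    y≤b = isLeader-minimal π y-leader (rel-euclid π j~b j~y)

module _ {n : ℕ} (π : Partition n) (i j : Fin n) where

  InUnion : Fin n → Set
  InUnion a = T (rel π i a) ⊎ T (rel π j a)

  inUnion : Fin n → Bool
  inUnion a = rel π i a ∨ rel π j a

  inUnion-closed : ∀ {a b} → InUnion a → T (rel π a b) → InUnion b
  inUnion-closed {a} {b} (inj₁ i~a) a~b = inj₁ (rel-trans π i a b i~a a~b)
  inUnion-closed {a} {b} (inj₂ j~a) a~b = inj₂ (rel-trans π j a b j~a a~b)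

  data Merged (a b : Fin n) : Set where
    same : T (rel π a b) → Merged a b
    both : InUnion a → InUnion b → Merged a b

  mergedᵇ : Fin n → Fin n → Bool
  mergedᵇ a b = rel π a b ∨ (inUnion a ∧ inUnion b)

  T-mergedᵇ : ∀ {a b} → T (mergedᵇ a b) ⇔ Merged a b
  T-mergedᵇ {a} {b} = mk⇔ to from
    where
    to : T (mergedᵇ a b) → Merged a b
    to t with Equivalence.to (T-∨ {rel π a b}) t
    ... | inj₁ a~b = same a~b
    ... | inj₂ ta∧tb =
      let ta , tb = Equivalence.to (T-∧ {inUnion a}) ta∧tb
      in both (Equivalence.to (T-∨ {rel π i a}) ta) (Equivalence.to (T-∨ {rel π i b}) tb)
    from : Merged a b → T (mergedᵇ a b)
    from (same a~b) = Equivalence.from (T-∨ {rel π a b}) (inj₁ a~b)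
    from (both ta tb) = Equivalence.from (T-∨ {rel π a b}) (inj₂ (Equivalence.from (T-∧ {inUnion a})
      (Equivalence.from (T-∨ {rel π i a}) ta , Equivalence.from (T-∨ {rel π i b}) tb)))

  merged-sym : ∀ {a b} → Merged a b → Merged b a
  merged-sym (same a~b)   = same (rel-sym π _ _ a~b)
  merged-sym (both ta tb) = both tb ta

  merged-trans : ∀ {a b c} → Merged a b → Merged b c → Merged a c
  merged-trans (same a~b)   (same b~c)   = same (rel-trans π _ _ _ a~b b~c)
  merged-trans (same a~b)   (both tb tc) = both (inUnion-closed tb (rel-sym π _ _ a~b)) tc
  merged-trans (both ta tb) (same b~c)   = both ta (inUnion-closed tb b~c)
  merged-trans (both ta _)  (both _ tc)  = both ta tc

  merge : Partition n
  merge = record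
    { rel       = mergedᵇ
    ; rel-refl  = λ a → Equivalence.from T-mergedᵇ (same (rel-refl π a))
    ; rel-sym   = λ a b → Equivalence.from T-mergedᵇ ∘ merged-sym ∘ Equivalence.to T-mergedᵇ
    ; rel-trans = λ a b c a~b b~c → Equivalence.from T-mergedᵇ
                    (merged-trans (Equivalence.to T-mergedᵇ a~b) (Equivalence.to T-mergedᵇ b~c))
    }

  refines-merge : Refines π merge
  refines-merge a b = Equivalence.from T-mergedᵇ ∘ same

  merge-relates : T (rel merge i j)
  merge-relates = Equivalence.from T-mergedᵇ (both (inj₁ (rel-refl π i)) (inj₂ (rel-refl π j)))

  merge-least : ∀ {π′} → Refines π π′ → T (rel π′ i j) → Refines merge π′
  merge-least {π′} π≤π′ i~′j a b a~b with Equivalence.to T-mergedᵇ a~b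
  ... | same a~b′  = π≤π′ a b a~b′
  ... | both ta tb = rel-euclid π′ (i~′ ta) (i~′ tb)
    where
    i~′ : ∀ {c} → InUnion c → T (rel π′ i c)
    i~′ {c} (inj₁ i~c) = π≤π′ i c i~c
    i~′ {c} (inj₂ j~c) = rel-trans π′ i j c i~′j (π≤π′ j c j~c)

  demoted-leadsAbove : ∀ {x} → T (isLeader π x) → ¬ T (isLeader merge x) →
                       LeadsAbove π i j x ⊎ LeadsAbove π j i x
  demoted-leadsAbove {x} x-leader ¬x-leader′ with ¬isLeader⇒smaller merge ¬x-leader′
  ... | b , b<x , b~′x = classify (Equivalence.to T-mergedᵇ b~′x)
    where
    ¬b~x : ¬ T (rel π b x)
    ¬b~x b~x = <⇒≱ b<x (isLeader-minimal π x-leader b~x)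
    classify : Merged b x → LeadsAbove π i j x ⊎ LeadsAbove π j i x
    classify (same b~x)                   = ⊥-elim (¬b~x b~x)
    classify (both (inj₁ i~b) (inj₂ j~x)) = inj₂ (j~x , b , b<x , i~b)
    classify (both (inj₂ j~b) (inj₁ i~x)) = inj₁ (i~x , b , b<x , j~b)
    classify (both (inj₁ i~b) (inj₁ i~x)) = ⊥-elim (¬b~x (rel-euclid π i~b i~x))
    classify (both (inj₂ j~b) (inj₂ j~x)) = ⊥-elim (¬b~x (rel-euclid π j~b j~x))

  numBlocks-merge-≤ : numBlocks π ≤ suc (numBlocks merge)
  numBlocks-merge-≤ = count-≤-suc atMostOne (allFin⁺ n)
    where
    atMostOne : ∀ x y → T (isLeader π x) → ¬ T (isLeader merge x) →
                T (isLeader π y) → ¬ T (isLeader merge y) → x ≡ y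
    atMostOne x y x-leader ¬x-leader′ y-leader ¬y-leader′
      with demoted-leadsAbove x-leader ¬x-leader′ | demoted-leadsAbove y-leader ¬y-leader′
    ... | inj₁ (i~x , _) | inj₁ (i~y , _) = isLeader-unique′ π x-leader y-leader i~x i~y
    ... | inj₂ (j~x , _) | inj₂ (j~y , _) = isLeader-unique′ π x-leader y-leader j~x j~y
    ... | inj₁ x-above | inj₂ y-above = ⊥-elim (¬leadsAbove-both π x-leader y-leader x-above y-above)
    ... | inj₂ x-above | inj₁ y-above = ⊥-elim (¬leadsAbove-both π y-leader x-leader y-above x-above)

  numBlocks-merge : ¬ T (rel π i j) → numBlocks π ≡ suc (numBlocks merge)
  numBlocks-merge ¬i~j =
    ≤-antisym numBlocks-merge-≤ (numBlocks-strict π merge refines-merge merge-relates ¬i~j)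

m∸n≡1+[m∸[1+n]] : ∀ {m n} → n < m → m ∸ n ≡ suc (m ∸ suc n)
m∸n≡1+[m∸[1+n]] {suc m} {zero}  _         = refl
m∸n≡1+[m∸[1+n]] {suc m} {suc n} (s≤s n<m) = m∸n≡1+[m∸[1+n]] n<m

module _ {n : ℕ} where

  rank : C n → ℕ
  rank bot         = 0
  rank (emb _ π _) = n ∸ numBlocks π + 1

  rank-≤ : ∀ x → rank x ≤ n
  rank-≤ bot = z≤n
  rank-≤ (emb S π ((s , _) , _)) = begin
    n ∸ numBlocks π + 1           ≤⟨ +-monoʳ-≤ (n ∸ numBlocks π) (numBlocks-pos π s) ⟩
    n ∸ numBlocks π + numBlocks π ≡⟨ m∸n+n≡m (numBlocks-≤ π) ⟩
    n                             ∎
    where open ≤-Reasoning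

  rank-mono : ∀ {x y} → x ⊑ y → rank x ≤ rank y
  rank-mono {bot}                    _          = z≤n
  rank-mono {emb _ π _} {emb _ π′ _} (_ , π≤π′) =
    +-monoˡ-≤ 1 (∸-monoʳ-≤ n (numBlocks-antitone π π′ π≤π′))

  ⊏-separates : ∀ {S S′ : Subset n} {π π′ b b′} → emb S π b ⊏ emb S′ π′ b′ →
                ∃ λ i → ∃ λ j → T (rel π′ i j) × ¬ T (rel π i j)
  ⊏-separates {π = π} {π′} {b@((s , s∈S) , _)} {b′} ((S⊆S′ , _) , ¬y⊑x) =
    ¬Refines⇒separated π′ π λ π′≤π →
      ¬y⊑x (block-⊆ π′ π π′≤π b′ b (S⊆S′ s∈S) s∈S , π′≤π)

  rank-strict : ∀ {x y} → x ⊏ y → rank x < rank y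
  rank-strict {bot} {bot} (_ , ¬y⊑x) = ⊥-elim (¬y⊑x tt)
  rank-strict {bot} {emb _ π _} _ = m≤n+m 1 (n ∸ numBlocks π)
  rank-strict {emb S π b} {emb S′ π′ b′} x⊏y@((_ , π≤π′) , _) =
    let i , j , i~′j , ¬i~j = ⊏-separates {S} {S′} {π} {π′} {b} {b′} x⊏y in
    +-monoˡ-< 1 (∸-monoʳ-< (numBlocks-strict π π′ π≤π′ i~′j ¬i~j) (numBlocks-≤ π))

  ⊏-step : ∀ {x y} → x ⊏ y → ∃ λ z → x ⊏ z × z ⊑ y × rank z ≡ suc (rank x)
  ⊏-step {bot} {bot} (_ , ¬y⊑x) = ⊥-elim (¬y⊑x tt)
  ⊏-step {bot} {emb S π b@((s , s∈S) , _)} _ =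
    emb (blockOf discrete s) discrete singleton ,
    (tt , λ ()) ,
    (block-⊆ discrete π (discrete-refines π) singleton b s∈singleton s∈S , discrete-refines π) ,
    cong (_+ 1) (trans (cong (n ∸_) (numBlocks-discrete {n})) (n∸n≡0 n))
    where
    singleton : IsBlock (blockOf discrete s) discrete
    singleton = blockOf-isBlock discrete s
    s∈singleton : s ∈ blockOf discrete s
    s∈singleton = Equivalence.from (∈-blockOf discrete) (rel-refl discrete s)
  ⊏-step {emb S π b@((s , s∈S) , _)} {emb S′ π′ b′} x⊏y@((S⊆S′ , π≤π′) , _) =
    let i , j , i~′j , ¬i~j = ⊏-separates {S} {S′} {π} {π′} {b} {b′} x⊏y
        μ = merge π i j
        μ≤π′ = merge-least π i j {π′} π≤π′ i~′j
        B = blockOf-isBlock μ s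
        s∈B = Equivalence.from (∈-blockOf μ) (rel-refl μ s)
        π-blocks = numBlocks-merge π i j ¬i~j
    in emb (blockOf μ s) μ B ,
       ((block-⊆ π μ (refines-merge π i j) b B s∈S s∈B , refines-merge π i j) ,
        λ (_ , μ≤π) → ¬i~j (μ≤π i j (merge-relates π i j))) ,
       (block-⊆ μ π′ μ≤π′ B b′ s∈B (S⊆S′ s∈S) , μ≤π′) ,
       cong (_+ 1) (trans (m∸n≡1+[m∸[1+n]] (subst (_≤ n) π-blocks (numBlocks-≤ π)))
                          (cong (suc ∘ (n ∸_)) (sym π-blocks)))

  ⊑-rank-<⇒⊏ : ∀ {x y} → x ⊑ y → rank x < rank y → x ⊏ y
  ⊑-rank-<⇒⊏ x⊑y rx<ry = x⊑y , λ y⊑x → <⇒≱ rx<ry (rank-mono y⊑x)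

  rank-suc⇒⋖ : ∀ {x y} → x ⊏ y → rank y ≡ suc (rank x) → x ⋖ y
  rank-suc⇒⋖ x⊏y ry≡1+rx = x⊏y , λ z x⊏z z⊏y →
    <⇒≱ (rank-strict z⊏y) (subst (_≤ rank z) (sym ry≡1+rx) (rank-strict x⊏z))

  ⋖⇒rank-suc : ∀ {x y} → x ⋖ y → rank y ≡ suc (rank x)
  ⋖⇒rank-suc {x} {y} (x⊏y , nothingBetween) with ⊏-step x⊏y
  ... | z , x⊏z , z⊑y , rz≡1+rx = ≤-antisym ry≤rz (rank-strict x⊏y)
    where
    ry≤rz : rank y ≤ suc (rank x)
    ry≤rz = subst (rank y ≤_) rz≡1+rx
      (≮⇒≥ λ rz<ry → nothingBetween z x⊏z (⊑-rank-<⇒⊏ z⊑y rz<ry))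

  maxChain-rank : ∀ {x y l} → MaxChain x y l → rank y ≡ l + rank x
  maxChain-rank [] = refl
  maxChain-rank {x} {y} {suc l} (_∷_ {y = w} x⋖w chain) = begin
    rank y           ≡⟨ maxChain-rank chain ⟩
    l + rank w       ≡⟨ cong (l +_) (⋖⇒rank-suc x⋖w) ⟩
    l + suc (rank x) ≡⟨ +-suc l (rank x) ⟩
    suc l + rank x   ∎
    where open ≡-Reasoning

  chain-rank : ∀ {x y m} → Chain x y m → m + rank x ≤ rank y
  chain-rank [] = ≤-refl
  chain-rank {x} {y} {suc m} (_∷_ {y = w} x⊏w chain) = begin
    suc m + rank x   ≡⟨ sym (+-suc m (rank x)) ⟩
    m + suc (rank x) ≤⟨ +-monoʳ-≤ m (rank-strict x⊏w) ⟩
    m + rank w       ≤⟨ chain-rank chain ⟩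
    rank y           ∎
    where open ≤-Reasoning

  maxChain : ∀ k {x y} → x ⊏ y → rank y ≡ suc k + rank x → MaxChain x y (suc k)
  maxChain zero    x⊏y ry≡ = rank-suc⇒⋖ x⊏y ry≡ ∷ []
  maxChain (suc k) {x} {y} x⊏y ry≡ with ⊏-step x⊏y
  ... | z , x⊏z , z⊑y , rz≡1+rx =
    rank-suc⇒⋖ x⊏z rz≡1+rx ∷ maxChain k (⊑-rank-<⇒⊏ z⊑y rz<ry) ry≡rz
    where
    ry≡rz : rank y ≡ suc k + rank z
    ry≡rz = trans ry≡ (cong suc (trans (sym (+-suc k (rank x))) (cong (k +_) (sym rz≡1+rx))))
    rz<ry : rank z < rank y
    rz<ry = subst (rank z <_) (sym ry≡rz) (s≤s (m≤n+m (rank z) k))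

  maxChain-from-bot : ∀ {S π} (b : IsBlock S π) → MaxChain bot (emb S π b) (rank (emb S π b))
  maxChain-from-bot {π = π} b = subst (MaxChain bot _) (+-comm 1 k)
    (maxChain k (tt , λ ()) (trans (+-comm k 1) (cong suc (sym (+-identityʳ k)))))
    where
    k = n ∸ numBlocks π

  maxChain-length-unique : ∀ {x y l l′} → MaxChain x y l → MaxChain x y l′ → l ≡ l′
  maxChain-length-unique {x} {_} {l} {l′} c c′ =
    +-cancelʳ-≡ (rank x) l l′ (trans (sym (maxChain-rank c)) (maxChain-rank c′))

  maxChain-from-bot-length : ∀ {y l} → MaxChain bot y l → l ≡ rank y
  maxChain-from-bot-length {l = l} c = trans (sym (+-identityʳ l)) (sym (maxChain-rank c))

  chain-length-≤ : ∀ {x y l} → Chain x y l → l ≤ n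
  chain-length-≤ {x} {y} {l} c = ≤-trans (m≤m+n l (rank x)) (≤-trans (chain-rank c) (rank-≤ y))

MaxChain⇒Chain : ∀ {n} {x y : C n} {l} → MaxChain x y l → Chain x y l
MaxChain⇒Chain []            = []
MaxChain⇒Chain (x⋖y ∷ chain) = proj₁ x⋖y ∷ MaxChain⇒Chain chain

proposition2 : (n : ℕ) → 2 < n →
    ((x y : C n) (l m : ℕ) → MaxChain x y l → MaxChain x y m → l ≡ m)
    × ((S : _) (π : Partition n) (b : IsBlock S π) →
         Σ ℕ (λ l → MaxChain bot (emb S π b) l)
         × ((l : ℕ) → MaxChain bot (emb S π b) l → l ≡ n ∸ numBlocks π + 1))
    × ((x y : C n) (m : ℕ) → Chain x y m → m ≤ n)
    × Σ (C n) (λ x → Σ (C n) (λ y → Chain x y n))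
proposition2 n@(suc m) _ =
    (λ _ _ _ _ → maxChain-length-unique)
  , (λ _ _ b → (_ , maxChain-from-bot b) , λ _ → maxChain-from-bot-length)
  , (λ _ _ _ → chain-length-≤)
  , bot , top , subst (Chain bot top) rank-top (MaxChain⇒Chain (maxChain-from-bot top-block))
  where
  top-block : IsBlock (blockOf indiscrete fzero) indiscrete
  top-block = blockOf-isBlock indiscrete fzero
  top : C n
  top = emb (blockOf indiscrete fzero) indiscrete top-block
  rank-top : rank top ≡ n
  rank-top = trans (cong (λ k → n ∸ k + 1) (numBlocks-indiscrete {m})) (+-comm m 1)
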